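{- Let $L$ and $X$ be languages over an alphabet $\Sigma$. (1) If $L \neq \varnothing$, then $L$ has a proper subset that is a separating set of factors of $L$. (2) If $X$ is a separating set of factors of $L$ and $K \subseteq L$, then $X$ is a separating set of factors of $K$. (3) If $X$ is a separating set of factors of $L$ and $X \subseteq Y$, then $Y$ is a separating set of factors of $L$. (4) If $X$ is a separating set of factors of $L$, then $X$ has a subset that is an inclusion-minimal separating set of factors of $L$.
   Context: For words $w, x$, $|w|_x$ is the number of pairs of words $(s,t)$ with $w = sxt$. A language $X$ is a separating set of factors (SSF) of $L$ if for all distinct $u, v \in L$ there is $x \in X$ with $|u|_x \neq |v|_x$. An SSF $X$ of $L$ is inclusion-minimal if no proper subset of $X$ is an SSF of $L$. -}

module Defs where

open import Level using (0ℓ)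
open import Data.Nat using (ℕ)
open import Data.Empty using (⊥)
open import Data.Fin using (Fin) renaming (_≟_ to _≟ᶠ_)
open import Data.List using (List; _++_; length; filter; inits; tails; cartesianProduct)
open import Data.List.Properties using (≡-dec)
open import Data.Product using (_×_; _,_; ∃; proj₁; proj₂)
open import Relation.Binary.PropositionalEquality using (_≡_; _≢_)
open import Relation.Unary using (Pred; _⊂_)

Word : ℕ → Set
Word k = List (Fin k)

Language : ℕ → Set₁
Language k = Pred (Word k) 0ℓ

-- |w|_x : the number of pairs of words (s , t) with w = s x t.
-- Any such s is a prefix of w and t a suffix of w, so it suffices to count
-- the pairs in (inits w) × (tails w) (both lists are duplicate-free).
occ : ∀ {k} → Word k → Word k → ℕ
occ {k} w x =
  length (filter (λ st → ≡-dec _≟ᶠ_ w (proj₁ st ++ x ++ proj₂ st))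
                 (cartesianProduct (inits w) (tails w)))

SSF : ∀ {k} → Language k → Language k → Set
SSF X L = ∀ u v → L u → L v → u ≢ v → ∃ λ x → X x × occ u x ≢ occ v x

MinimalSSF : ∀ {k} → Language k → Language k → Set₁
MinimalSSF {k} X L = SSF X L × ((Y : Language k) → Y ⊂ X → SSF Y L → ⊥)

module Submission where

-- Parts (2) and (3) are immediate: separating more words is harder, and a
-- larger set of candidate factors separates at least as much.
--
-- Part (1): let w₀ be a shortest word of L (classical least-element
-- principle).  Then L ∖ {w₀} is an SSF of L: of two distinct words
-- u, v with |v| ≤ |u|, the longer one u separates them (|u|_u ≥ 1 while
-- |v|_u = 0); and if u = w₀, then v is at least as long as u, so v
-- separates them instead.  Excluded middle (a hypothesis of the theorem)
-- is used for the least element and for the minimality in part (4).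
--
-- Part (4) is an instance of a general fact about hitting sets: if X
-- meets every set of a family C, and each C i is bounded with respect to
-- an injective numbering of the elements, then greedily discarding elements
-- of X in the order of their numbers (whenever the rest still meets every
-- C i) yields, in the limit, a minimal subset of X meeting every C i.
-- An SSF of L is exactly a set meeting every set of separating factors
-- of a pair of distinct words of L; a separating factor of u, v occurs in
-- u or in v, so it is no longer than them, which bounds its number.

open import Defs
open import Level using (0ℓ)
open import Axiom.ExcludedMiddle using (ExcludedMiddle)
open import Data.Nat using (ℕ; zero; suc; _+_; _*_; _≤_; _<_; _≤′_; ≤′-refl; ≤′-step; z≤n; s≤s; _⊔_; _≟_)
open import Data.Nat.Properties
open import Data.Nat.DivMod using (_%_; [m+kn]%n≡m%n; m<n⇒m%n≡m)
open import Data.Nat.Induction using (<-wellFounded)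
open import Induction.WellFounded using (Acc; acc)
open import Data.Fin using (toℕ) renaming (_≟_ to _≟ᶠ_)
open import Data.Fin.Properties using (toℕ<n; toℕ-injective)
open import Data.List using (List; []; _∷_; _++_; length; inits; tails; cartesianProduct)
open import Data.List.Properties using (≡-dec; length-++; ++-identityʳ; filter-some; filter-none)
open import Data.List.Membership.Propositional using (_∈_; lose)
open import Data.List.Membership.Propositional.Properties using (∈-cartesianProduct⁺)
open import Data.List.Relation.Unary.Any using (Any; here; there)
open import Data.List.Relation.Unary.All using (tabulate)
open import Data.Product using (_×_; Σ; ∃; _,_; proj₁; proj₂)
open import Data.Sum using (inj₁; inj₂)
open import Data.Empty using (⊥; ⊥-elim)
open import Relation.Nullary using (¬_; Dec; yes; no)
open import Relation.Unary using (Pred; Satisfiable; _⊆_; _⊂_)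
open import Relation.Binary.PropositionalEquality
  using (_≡_; _≢_; refl; sym; trans; cong; cong₂; subst; ≢-sym; module ≡-Reasoning)

module _ (lem : ExcludedMiddle 0ℓ) {A : Set} where

  least-element : (μ : A → ℕ) {P : Pred A 0ℓ} → Satisfiable P →
                  ∃ λ m → P m × (∀ b → P b → μ m ≤ μ b)
  least-element μ {P} (a , Pa) = go a (<-wellFounded (μ a)) Pa
    where
    go : ∀ a → Acc _<_ (μ a) → P a → ∃ λ m → P m × (∀ b → P b → μ m ≤ μ b)
    go a (acc smaller) Pa with lem {∃ λ b → P b × μ b < μ a}
    ... | yes (b , Pb , b<a) = go b (smaller b<a) Pb
    ... | no none = a , Pa , λ b Pb → ≮⇒≥ (λ b<a → none (b , Pb , b<a))

  element-outside : {P Q : Pred A 0ℓ} → ¬ (P ⊆ Q) → ∃ λ x → P x × ¬ Q x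
  element-outside {P} {Q} P⊈Q with lem {∃ λ x → P x × ¬ Q x}
  ... | yes witness = witness
  ... | no none = ⊥-elim (P⊈Q in-Q)
    where
    in-Q : P ⊆ Q
    in-Q {x} Px with lem {Q x}
    ... | yes Qx = Qx
    ... | no ¬Qx = ⊥-elim (none (x , Px , ¬Qx))

module HittingSets {A I : Set} (C : I → Pred A 0ℓ) where

  Hits : Pred A 0ℓ → Set
  Hits X = ∀ i → ∃ λ x → X x × C i x

  hits-mono : {X Y : Pred A 0ℓ} → X ⊆ Y → Hits X → Hits Y
  hits-mono X⊆Y hits i with hits i
  ... | x , Xx , Cx = x , X⊆Y Xx , Cx

  module _ (lem : ExcludedMiddle 0ℓ) (code : A → ℕ)
           (code-injective : ∀ {x y} → code x ≡ code y → x ≡ y) where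

    _without_ : Pred A 0ℓ → ℕ → Pred A 0ℓ
    (X without n) x = X x × code x ≢ n

    step : (X : Pred A 0ℓ) (n : ℕ) → Dec (Hits (X without n)) → Pred A 0ℓ
    step X n (yes _) = X without n
    step X n (no _) = X

    step-⊆ : ∀ {X n} d → step X n d ⊆ X
    step-⊆ (yes _) = proj₁
    step-⊆ (no _) Xx = Xx

    step-hits : ∀ {X n} d → Hits X → Hits (step X n d)
    step-hits (yes hits) _ = hits
    step-hits (no _) hits = hits

    step-keeps : ∀ {X n x} d → X x → code x ≢ n → step X n d x
    step-keeps (yes _) Xx x≢n = Xx , x≢n
    step-keeps (no _) Xx _ = Xx

    step-survivor : ∀ {X n x} d → step X n d x → code x ≡ n → ¬ Hits (X without n)
    step-survivor (yes _) (_ , x≢n) x≡n = ⊥-elim (x≢n x≡n)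
    step-survivor (no cannot) _ _ = cannot

    module Greedy (X : Pred A 0ℓ) (X-hits : Hits X) where

      stage : ℕ → Pred A 0ℓ
      stage zero = X
      stage (suc n) = step (stage n) n lem

      stage-hits : ∀ n → Hits (stage n)
      stage-hits zero = X-hits
      stage-hits (suc n) = step-hits lem (stage-hits n)

      stage-antitone : ∀ {m n} → m ≤′ n → stage n ⊆ stage m
      stage-antitone ≤′-refl Sx = Sx
      stage-antitone (≤′-step m≤n) Sx = stage-antitone m≤n (step-⊆ lem Sx)

      limit : Pred A 0ℓ
      limit x = ∀ n → stage n x

      -- The fate of x is settled at step `code x`.
      survives : ∀ {x} → stage (suc (code x)) x → limit x
      survives {x} Sx n with ≤-total n (suc (code x))
      ... | inj₁ n≤ = stage-antitone (≤⇒≤′ n≤) Sx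
      ... | inj₂ ≤n = kept (≤⇒≤′ ≤n)
        where
        kept : ∀ {n} → suc (code x) ≤′ n → stage n x
        kept ≤′-refl = Sx
        kept (≤′-step ≤n) = step-keeps lem (kept ≤n) (<⇒≢ (≤′⇒≤ ≤n))

      limit-hits : (∀ i → ∃ λ N → ∀ x → C i x → code x < N) → Hits limit
      limit-hits bounded i with bounded i
      ... | N , below with stage-hits N i
      ... | x , Sx , Cx = x , survives (stage-antitone (≤⇒≤′ (below x Cx)) Sx) , Cx

      -- If Y ⊂ limit hit C, discarding some x ∈ limit ∖ Y at step `code x`
      -- would have left a superset of Y, which hits C: so x was discarded.
      limit-minimal : (Y : Pred A 0ℓ) → Y ⊂ limit → Hits Y → ⊥
      limit-minimal Y (Y⊆limit , limit⊈Y) Y-hits with element-outside lem limit⊈Y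
      ... | x , limit-x , ¬Yx =
        step-survivor lem (limit-x (suc (code x))) refl (hits-mono Y⊆rest Y-hits)
        where
        Y⊆rest : Y ⊆ stage (code x) without code x
        Y⊆rest {y} Yy = Y⊆limit Yy (code x) , λ y≡x → ¬Yx (subst Y (code-injective y≡x) Yy)

    minimal-hitting-subset : (∀ i → ∃ λ N → ∀ x → C i x → code x < N) →
      (X : Pred A 0ℓ) → Hits X →
      Σ (Pred A 0ℓ) λ Z → Z ⊆ X × Hits Z × ((Y : Pred A 0ℓ) → Y ⊂ Z → Hits Y → ⊥)
    minimal-hitting-subset bounded X X-hits =
      limit , (λ limit-x → limit-x 0) , limit-hits bounded , limit-minimal
      where open Greedy X X-hits

digit-unique : ∀ {n a b q r} → a < n → b < n → a + q * n ≡ b + r * n → a ≡ b × q ≡ r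
digit-unique {suc n} {a} {b} {q} {r} a<n b<n eq = a≡b , quotients
  where
  a≡b : a ≡ b
  a≡b = begin
    a                       ≡⟨ m<n⇒m%n≡m a<n ⟨
    a % suc n               ≡⟨ [m+kn]%n≡m%n a q (suc n) ⟨
    (a + q * suc n) % suc n ≡⟨ cong (_% suc n) eq ⟩
    (b + r * suc n) % suc n ≡⟨ [m+kn]%n≡m%n b r (suc n) ⟩
    b % suc n               ≡⟨ m<n⇒m%n≡m b<n ⟩
    b                       ∎
    where open ≡-Reasoning
  quotients : q ≡ r
  quotients = *-cancelʳ-≡ q r (suc n) (+-cancelˡ-≡ a _ _ (trans eq (cong (_+ r * suc n) (sym a≡b))))

module _ {A : Set} where

  factor-length : (s x t : List A) → length x ≤ length (s ++ x ++ t)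
  factor-length s x t = begin
    length x                   ≤⟨ m≤m+n (length x) (length t) ⟩
    length x + length t        ≡⟨ length-++ x ⟨
    length (x ++ t)            ≤⟨ m≤n+m (length (x ++ t)) (length s) ⟩
    length s + length (x ++ t) ≡⟨ length-++ s ⟨
    length (s ++ x ++ t)       ∎
    where open ≤-Reasoning

  factor-of-no-longer : (s x t : List A) → length (s ++ x ++ t) ≤ length x → s ++ x ++ t ≡ x
  factor-of-no-longer [] x [] _ = ++-identityʳ x
  factor-of-no-longer [] x (b ∷ t) long =
    ⊥-elim (m+1+n≰m (length x) (subst (_≤ length x) (length-++ x) long))
  factor-of-no-longer (a ∷ s) x t long = ⊥-elim (<⇒≱ (s≤s (factor-length s x t)) long)

module _ {k : ℕ} where

  W : Set
  W = Word k

  splits? : (w x : W) (st : W × W) → Dec (w ≡ proj₁ st ++ x ++ proj₂ st)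
  splits? w x st = ≡-dec _≟ᶠ_ w (proj₁ st ++ x ++ proj₂ st)

  []∈tails : (w : W) → [] ∈ tails w
  []∈tails [] = here refl
  []∈tails (a ∷ w) = there ([]∈tails w)

  -- Every word occurs in itself, via w = [] w [].
  occ-self : (w : W) → occ w w ≢ 0
  occ-self w absent = <⇒≢ (filter-some (splits? w w) trivial-split) (sym absent)
    where
    trivial-split : Any (λ st → w ≡ proj₁ st ++ w ++ proj₂ st) (cartesianProduct (inits w) (tails w))
    trivial-split = lose (∈-cartesianProduct⁺ {xs = inits w} (here refl) ([]∈tails w))
                         (sym (++-identityʳ w))

  occ-non-factor : {w x : W} → (∀ s t → w ≢ s ++ x ++ t) → occ w x ≡ 0
  occ-non-factor {w} {x} none = cong length
    (filter-none (splits? w x) {xs = cartesianProduct (inits w) (tails w)}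
      (tabulate λ {st} _ → none (proj₁ st) (proj₂ st)))

  occurring-is-shorter : {w x : W} → occ w x ≢ 0 → length x ≤ length w
  occurring-is-shorter {w} {x} occurs with length x ≤? length w
  ... | yes x≤w = x≤w
  ... | no x≰w = ⊥-elim (occurs (occ-non-factor {w} {x} λ s t w≡ →
                   x≰w (subst (λ w → length x ≤ length w) (sym w≡) (factor-length s x t))))

  occ-no-shorter : {w x : W} → length w ≤ length x → w ≢ x → occ w x ≡ 0
  occ-no-shorter {w} {x} w≤x w≢x = occ-non-factor {w} {x} λ s t w≡ →
    w≢x (trans w≡ (factor-of-no-longer s x t (subst (λ w → length w ≤ length x) w≡ w≤x)))

  longer-separates : {u v : W} → length v ≤ length u → u ≢ v → occ u u ≢ occ v u
  longer-separates {u} {v} v≤u u≢v same =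
    occ-self u (trans same (occ-no-shorter {v} {u} v≤u (≢-sym u≢v)))

  -- A separating factor occurs in one of the two words.
  separating-is-short : {u v x : W} → occ u x ≢ occ v x → length x ≤ length u ⊔ length v
  separating-is-short {u = u} {v = v} {x = x} differ with occ u x ≟ 0
  ... | yes none-in-u =
    ≤-trans (occurring-is-shorter {v} {x} (λ none-in-v → differ (trans none-in-u (sym none-in-v))))
            (m≤n⊔m (length u) (length v))
  ... | no occurs = ≤-trans (occurring-is-shorter {u} {x} occurs) (m≤m⊔n (length u) (length v))

  -- An injective numbering of words by bijective base-k notation.
  code : W → ℕ
  code [] = 0
  code (a ∷ w) = suc (toℕ a + code w * k)

  code-injective : {x y : W} → code x ≡ code y → x ≡ y
  code-injective {[]} {[]} _ = refl
  code-injective {a ∷ x} {b ∷ y} eq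
    with a≡b , x≡y ← digit-unique (toℕ<n a) (toℕ<n b) (suc-injective eq)
    = cong₂ _∷_ (toℕ-injective a≡b) (code-injective x≡y)

  code-bound : ℕ → ℕ
  code-bound zero = 0
  code-bound (suc n) = suc (k + code-bound n * k)

  code-bound-mono : {m n : ℕ} → m ≤ n → code-bound m ≤ code-bound n
  code-bound-mono z≤n = z≤n
  code-bound-mono (s≤s m≤n) = s≤s (+-monoʳ-≤ k (*-monoˡ-≤ k (code-bound-mono m≤n)))

  code≤bound : (w : W) → code w ≤ code-bound (length w)
  code≤bound [] = z≤n
  code≤bound (a ∷ w) = s≤s (+-mono-≤ (<⇒≤ (toℕ<n a)) (*-monoˡ-≤ k (code≤bound w)))

open HittingSets using (Hits; minimal-hitting-subset)

module _ {k : ℕ} where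

  ssf-sublanguage : (X L K : Language k) → SSF X L → K ⊆ L → SSF X K
  ssf-sublanguage X L K X-sep K⊆L u v Ku Kv u≢v = X-sep u v (K⊆L Ku) (K⊆L Kv) u≢v

  ssf-superset : (X Y L : Language k) → SSF X L → X ⊆ Y → SSF Y L
  ssf-superset X Y L X-sep X⊆Y u v Lu Lv u≢v with X-sep u v Lu Lv u≢v
  ... | x , Xx , differ = x , X⊆Y Xx , differ

  ssf-without-shortest : (L : Language k) (w₀ : Word k) → (∀ v → L v → length w₀ ≤ length v) →
                         SSF (λ x → L x × x ≢ w₀) L
  ssf-without-shortest L w₀ shortest u v Lu Lv u≢v
    with ≡-dec _≟ᶠ_ u w₀ | ≡-dec _≟ᶠ_ v w₀
  ... | yes refl | _ = v , (Lv , ≢-sym u≢v) , λ same → longer-separates (shortest v Lv) (≢-sym u≢v) (sym same)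
  ... | no u≢w₀ | yes refl = u , (Lu , u≢w₀) , longer-separates (shortest u Lu) u≢v
  ... | no u≢w₀ | no v≢w₀ with ≤-total (length v) (length u)
  ...   | inj₁ v≤u = u , (Lu , u≢w₀) , longer-separates v≤u u≢v
  ...   | inj₂ u≤v = v , (Lv , v≢w₀) , λ same → longer-separates u≤v (≢-sym u≢v) (sym same)

  proper-ssf : ExcludedMiddle 0ℓ → (L : Language k) → Satisfiable L →
               Σ (Language k) (λ X → X ⊂ L × SSF X L)
  proper-ssf lem L nonempty with least-element lem length nonempty
  ... | w₀ , Lw₀ , shortest =
    (λ x → L x × x ≢ w₀) , (proj₁ , λ L⊆X → proj₂ (L⊆X Lw₀) refl) ,
    ssf-without-shortest L w₀ shortest

  Distinct : Language k → Set
  Distinct L = Σ (Word k × Word k) λ uv → L (proj₁ uv) × L (proj₂ uv) × proj₁ uv ≢ proj₂ uv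

  Separating : {L : Language k} → Distinct L → Language k
  Separating ((u , v) , _) x = occ u x ≢ occ v x

  separating-bounded : {L : Language k} (p : Distinct L) →
                       ∃ λ N → ∀ x → Separating p x → code x < N
  separating-bounded ((u , v) , _) = suc (code-bound (length u ⊔ length v)) ,
    λ x differ → s≤s (≤-trans (code≤bound x)
                              (code-bound-mono (separating-is-short {u = u} {v = v} {x = x} differ)))

  ssf⇒hits : {Y L : Language k} → SSF Y L → Hits (Separating {L}) Y
  ssf⇒hits Y-sep ((u , v) , Lu , Lv , u≢v) = Y-sep u v Lu Lv u≢v

  hits⇒ssf : {Y L : Language k} → Hits (Separating {L}) Y → SSF Y L
  hits⇒ssf Y-hits u v Lu Lv u≢v = Y-hits ((u , v) , Lu , Lv , u≢v)

  minimal-ssf : ExcludedMiddle 0ℓ → (X L : Language k) → SSF X L →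
                Σ (Language k) (λ Z → Z ⊆ X × MinimalSSF Z L)
  minimal-ssf lem X L X-sep
    with minimal-hitting-subset (Separating {L}) lem code code-injective
           separating-bounded X (ssf⇒hits X-sep)
  ... | Z , Z⊆X , Z-hits , Z-minimal =
    Z , Z⊆X , hits⇒ssf Z-hits , λ Y Y⊂Z Y-sep → Z-minimal Y Y⊂Z (ssf⇒hits Y-sep)

lemma3 : ExcludedMiddle 0ℓ → (k : ℕ) →
    ((L : Language k) → Satisfiable L → Σ (Language k) (λ X → X ⊂ L × SSF X L))
    × ((X L K : Language k) → SSF X L → K ⊆ L → SSF X K)
    × ((X Y L : Language k) → SSF X L → X ⊆ Y → SSF Y L)
    × ((X L : Language k) → SSF X L → Σ (Language k) (λ Z → Z ⊆ X × MinimalSSF Z L))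
lemma3 lem k = proper-ssf lem , ssf-sublanguage , ssf-superset , minimal-ssf lem
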